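{- Let $\ell$ be a positive integer and let $G$ be a finite simple $K_{1,\ell+1}$-free graph with maximum degree $\Delta(G)\ge 1$. Then $G$ has adjacent vertices $v_1,v_2$ such that $|N_G[v_1]\cap N_G[v_2]|\ge \left\lceil \frac{\Delta(G)}{\ell}\right\rceil+1$. Moreover, if $G$ is claw-free, then $v_1,v_2$ can be chosen so that, in addition, $G$ has a clique of size $\Delta(G)-|N_G[v_1]\cap N_G[v_2]|+2$.
   Context: $K_{1,\ell+1}$-free means no induced subgraph isomorphic to the star $K_{1,\ell+1}$; claw-free means $K_{1,3}$-free. $N_G[v]=N_G(v)\cup\{v\}$ is the closed neighborhood. -}

module Defs where

open import Data.Nat using (ℕ; zero; suc; _+_; _∸_; _≤_; _⊔_; NonZero)
open import Data.Nat.DivMod using (_/_)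
open import Data.Bool using (Bool; true; false; _∧_; _∨_; T)
open import Data.Fin using (Fin; _≟_)
open import Data.List using (List; length; filterᵇ; map; foldr)
open import Data.List.Base using ()
open import Data.Fin.Base using ()
open import Data.Product using (Σ; _×_; ∃; ∃-syntax)
open import Relation.Nullary using (¬_)
open import Relation.Nullary.Decidable using (⌊_⌋)
open import Relation.Binary.PropositionalEquality using (_≡_; _≢_)
open import Function.Definitions using (Injective)
open import Data.List using (allFin) public

record Graph : Set where
  field
    n     : ℕ
    adj   : Fin n → Fin n → Bool
    sym   : ∀ u v → adj u v ≡ adj v u
    irref : ∀ v → adj v v ≡ false

open Graph public

Vertex : Graph → Set
Vertex G = Fin (n G)

Adjacent : (G : Graph) → Vertex G → Vertex G → Set
Adjacent G u v = adj G u v ≡ true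

countV : (G : Graph) → (Vertex G → Bool) → ℕ
countV G p = length (filterᵇ p (allFin (n G)))

degree : (G : Graph) → Vertex G → ℕ
degree G v = countV G (adj G v)

-- maximum degree Δ(G) (0 for the empty graph)
maxDegree : Graph → ℕ
maxDegree G = foldr _⊔_ 0 (map (degree G) (allFin (n G)))

inClosedNbhd : (G : Graph) → Vertex G → Vertex G → Bool
inClosedNbhd G v w = ⌊ v ≟ w ⌋ ∨ adj G v w

commonClosedNbhdSize : (G : Graph) → Vertex G → Vertex G → ℕ
commonClosedNbhdSize G v₁ v₂ =
  countV G (λ w → inClosedNbhd G v₁ w ∧ inClosedNbhd G v₂ w)

InducedStar : (G : Graph) → ℕ → Set
InducedStar G k =
  Σ (Vertex G) λ c → Σ (Fin k → Vertex G) λ f →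
    Injective _≡_ _≡_ f ×
    (∀ i → Adjacent G c (f i)) ×
    (∀ i j → i ≢ j → ¬ Adjacent G (f i) (f j))

StarFree : ℕ → Graph → Set
StarFree k G = ¬ InducedStar G k

ClawFree : Graph → Set
ClawFree = StarFree 3

HasClique : (G : Graph) → ℕ → Set
HasClique G k =
  Σ (Fin k → Vertex G) λ f →
    Injective _≡_ _≡_ f × (∀ i j → i ≢ j → Adjacent G (f i) (f j))

⌈_/_⌉ : ℕ → (d : ℕ) → .{{NonZero d}} → ℕ
⌈ m / d ⌉ = (m + d ∸ 1) / d

{-# OPTIONS --safe #-}
-- Let v have maximum degree Δ and put t = ⌈Δ/ℓ⌉. If every neighbour x of v had
-- |N[v] ∩ N[x]| ≤ t, then N[x] would contain at most t − 1 neighbours of v.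
-- Picking neighbours of v greedily, each outside the closed neighbourhoods of
-- those picked before, every pick rules out at most t − 1 of the Δ neighbours;
-- as ℓ(t − 1) < Δ this yields ℓ + 1 pairwise non-adjacent neighbours of v, an
-- induced K_{1,ℓ+1}. For an edge vu and claw-free G, v together with
-- N(v) ∖ N[u] is a clique, since two non-adjacent vertices there would form a
-- claw with u; it has at least Δ − (|N[v] ∩ N[u]| − 1) + 1 vertices.
module Submission where

open import Defs hiding (sym)
open import Data.Nat using (ℕ; zero; suc; _+_; _∸_; _*_; _≤_; _<_; _⊔_; NonZero; z≤n; s≤s; _≤?_)
open import Data.Nat.Properties hiding (_≟_)
open import Data.Nat.DivMod using (_/_; m/n*n≤m)
open import Data.Bool using (Bool; true; false; _∧_; _∨_; not; T)
open import Data.Bool.Properties using (T-≡; T-∧; T-∨) renaming (_≟_ to _≟ᵇ_)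
open import Data.Fin using (Fin; zero; suc; _≟_; inject≤)
open import Data.Fin.Properties using (inject≤-injective; any?)
open import Data.Vec.Functional using () renaming ([] to []ᶠ; _∷_ to _∷ᶠ_)
open import Data.List using (List; []; _∷_; length; filterᵇ; map; foldr; lookup)
open import Data.List.Relation.Unary.All as All using ()
open import Data.List.Relation.Unary.AllPairs using (_∷_)
open import Data.List.Relation.Unary.Any using (here; there)
open import Data.List.Relation.Unary.Unique.Propositional using (Unique)
open import Data.List.Relation.Unary.Unique.Propositional.Properties using (allFin⁺; filter⁺)
open import Data.List.Membership.Propositional using (_∈_)
open import Data.List.Membership.Propositional.Properties using (∈-lookup; ∈-filter⁻; ∈-allFin; ∈-map⁻)
open import Data.Product using (Σ; _×_; _,_; proj₁; proj₂)
open import Data.Sum using (_⊎_; inj₁; inj₂; [_,_])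
import Data.Sum as Sum
open import Data.Empty using (⊥-elim)
open import Relation.Nullary using (¬_; yes; no)
open import Relation.Nullary.Decidable using (⌊_⌋; T?; toWitness; fromWitness; _×-dec_)
open import Relation.Binary.PropositionalEquality using (_≡_; _≢_; refl; sym; trans; cong; subst)
open import Function.Base using (_∘_; _∘₂_)
open import Function.Bundles using (Equivalence)
open import Function.Definitions using (Injective)

open Equivalence using (to; from)

T-not⇒¬T : ∀ {b} → T (not b) → ¬ T b
T-not⇒¬T {false} _ ()

module _ {A : Set} where

  length-filterᵇ-mono : ∀ {p q : A → Bool} → (∀ x → T (p x) → T (q x)) →
    ∀ xs → length (filterᵇ p xs) ≤ length (filterᵇ q xs)
  length-filterᵇ-mono p⇒q [] = z≤n
  length-filterᵇ-mono {p} {q} p⇒q (x ∷ xs) with p x | q x | p⇒q x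
  ... | true  | true  | _     = s≤s (length-filterᵇ-mono p⇒q xs)
  ... | true  | false | p⇒qx = ⊥-elim (p⇒qx _)
  ... | false | true  | _     = m≤n⇒m≤1+n (length-filterᵇ-mono p⇒q xs)
  ... | false | false | _     = length-filterᵇ-mono p⇒q xs

  length-filterᵇ-split : ∀ (p q : A → Bool) xs →
    length (filterᵇ p xs) ≡
    length (filterᵇ (λ x → p x ∧ q x) xs) + length (filterᵇ (λ x → p x ∧ not (q x)) xs)
  length-filterᵇ-split p q [] = refl
  length-filterᵇ-split p q (x ∷ xs) with p x | q x
  ... | true  | true  = cong suc (length-filterᵇ-split p q xs)
  ... | true  | false = trans (cong suc (length-filterᵇ-split p q xs)) (sym (+-suc _ _))
  ... | false | _     = length-filterᵇ-split p q xs

  length-filterᵇ-∨ : ∀ {p q : A → Bool} → (∀ x → T (p x) → ¬ T (q x)) → ∀ xs →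
    length (filterᵇ (λ x → p x ∨ q x) xs) ≡ length (filterᵇ p xs) + length (filterᵇ q xs)
  length-filterᵇ-∨ disjoint [] = refl
  length-filterᵇ-∨ {p} {q} disjoint (x ∷ xs) with p x | q x | disjoint x
  ... | true  | true  | p∩q = ⊥-elim (p∩q _ _)
  ... | true  | false | _   = cong suc (length-filterᵇ-∨ disjoint xs)
  ... | false | true  | _   = trans (cong suc (length-filterᵇ-∨ disjoint xs)) (sym (+-suc _ _))
  ... | false | false | _   = length-filterᵇ-∨ disjoint xs

  length-filterᵇ-none : ∀ {p : A → Bool} → (∀ x → ¬ T (p x)) → ∀ xs → length (filterᵇ p xs) ≡ 0
  length-filterᵇ-none none [] = refl
  length-filterᵇ-none {p} none (x ∷ xs) with p x | none x
  ... | true  | ¬px = ⊥-elim (¬px _)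
  ... | false | _   = length-filterᵇ-none none xs

  length-filterᵇ-∈ : ∀ {p : A → Bool} {x xs} → x ∈ xs → T (p x) → 0 < length (filterᵇ p xs)
  length-filterᵇ-∈ {p} {x} (here refl) px with p x
  ... | true = s≤s z≤n
  length-filterᵇ-∈ {p} {xs = y ∷ _} (there x∈xs) px with p y
  ... | true  = m<n⇒m<1+n (length-filterᵇ-∈ x∈xs px)
  ... | false = length-filterᵇ-∈ x∈xs px

  lookup-injective : ∀ {xs : List A} → Unique xs → Injective _≡_ _≡_ (lookup xs)
  lookup-injective {_ ∷ _} _ {zero} {zero} _ = refl
  lookup-injective {_ ∷ xs} (x∉xs ∷ _) {zero} {suc j} x≡ =
    ⊥-elim (All.lookup x∉xs (∈-lookup {xs = xs} j) x≡)
  lookup-injective {_ ∷ xs} (x∉xs ∷ _) {suc i} {zero} ≡x =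
    ⊥-elim (All.lookup x∉xs (∈-lookup {xs = xs} i) (sym ≡x))
  lookup-injective {_ ∷ _} (_ ∷ unique) {suc i} {suc j} eq = cong suc (lookup-injective unique eq)

foldr-⊔-attained : ∀ xs → 0 < foldr _⊔_ 0 xs → foldr _⊔_ 0 xs ∈ xs
foldr-⊔-attained (x ∷ xs) pos with ⊔-sel x (foldr _⊔_ 0 xs)
... | inj₁ max≡x    = subst (_∈ x ∷ xs) (sym max≡x) (here refl)
... | inj₂ max≡rest =
  subst (_∈ x ∷ xs) (sym max≡rest) (there (foldr-⊔-attained xs (subst (0 <_) max≡rest pos)))

n*[⌈m/n⌉∸1]<m : ∀ m n .{{_ : NonZero n}} → 0 < m → n * (⌈ m / n ⌉ ∸ 1) < m
n*[⌈m/n⌉∸1]<m (suc m) n _ = s≤s (begin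
    n * (q ∸ 1)    ≡⟨ *-comm n (q ∸ 1) ⟩
    (q ∸ 1) * n    ≡⟨ *-distribʳ-∸ n q 1 ⟩
    q * n ∸ 1 * n  ≡⟨ cong (q * n ∸_) (*-identityˡ n) ⟩
    q * n ∸ n      ≤⟨ ∸-monoˡ-≤ n (m/n*n≤m (m + n) n) ⟩
    m + n ∸ n      ≡⟨ m+n∸n≡m m n ⟩
    m              ∎)
  where
  open ≤-Reasoning
  q = (m + n) / n

module _ (G : Graph) where

  adjacent-sym : ∀ {u v} → Adjacent G u v → Adjacent G v u
  adjacent-sym {u} {v} uv = trans (Graph.sym G v u) uv

  ¬adjacent : ∀ {v w} → adj G v w ≡ false → ¬ Adjacent G v w
  ¬adjacent v≁w v~w with () ← trans (sym v≁w) v~w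

  adjacent-irrefl : ∀ v → ¬ Adjacent G v v
  adjacent-irrefl v = ¬adjacent (Graph.irref G v)

  ≟-true⇒≡ : ∀ {v w : Vertex G} → T ⌊ v ≟ w ⌋ → v ≡ w
  ≟-true⇒≡ {v} {w} = toWitness {a? = v ≟ w}

  ≡⇒≟-true : ∀ {v w : Vertex G} → v ≡ w → T ⌊ v ≟ w ⌋
  ≡⇒≟-true {v} {w} = fromWitness {a? = v ≟ w}

  inClosedNbhd-refl : ∀ v → T (inClosedNbhd G v v)
  inClosedNbhd-refl v = from (T-∨ {⌊ v ≟ v ⌋}) (inj₁ (≡⇒≟-true refl))

  adjacent⇒inClosedNbhd : ∀ {v w} → Adjacent G v w → T (inClosedNbhd G v w)
  adjacent⇒inClosedNbhd vw = from T-∨ (inj₂ (from T-≡ vw))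

  inClosedNbhd⇒ : ∀ {v w} → T (inClosedNbhd G v w) → v ≡ w ⊎ Adjacent G v w
  inClosedNbhd⇒ = Sum.map ≟-true⇒≡ (to T-≡) ∘ to T-∨

  ∉ClosedNbhd⇒ : ∀ {v w} → ¬ T (inClosedNbhd G v w) → v ≢ w × ¬ Adjacent G v w
  ∉ClosedNbhd⇒ {v} w∉ = (λ { refl → w∉ (inClosedNbhd-refl v) }) , w∉ ∘ adjacent⇒inClosedNbhd

  maxDegree-attained : 0 < maxDegree G → Σ (Vertex G) λ v → degree G v ≡ maxDegree G
  maxDegree-attained Δ>0
    with v , _ , Δ≡ ← ∈-map⁻ (degree G) (foldr-⊔-attained (map (degree G) (allFin (n G))) Δ>0) = v , sym Δ≡

  countV-insert : ∀ v (R : Vertex G → Bool) → (∀ w → T (R w) → Adjacent G v w) →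
    suc (countV G R) ≤ countV G (λ w → ⌊ v ≟ w ⌋ ∨ R w)
  countV-insert v R R⊆N[v] = begin
    suc (countV G R)                         ≤⟨ +-monoˡ-≤ (countV G R) v-counted ⟩
    countV G (λ w → ⌊ v ≟ w ⌋) + countV G R  ≡⟨ sym (length-filterᵇ-∨ v∉R (allFin (n G))) ⟩
    countV G (λ w → ⌊ v ≟ w ⌋ ∨ R w)         ∎
    where
    open ≤-Reasoning
    v-counted : 0 < countV G (λ w → ⌊ v ≟ w ⌋)
    v-counted = length-filterᵇ-∈ (∈-allFin v) (≡⇒≟-true refl)
    v∉R : ∀ w → T ⌊ v ≟ w ⌋ → ¬ T (R w)
    v∉R w v≡w Rw with refl ← ≟-true⇒≡ v≡w = adjacent-irrefl v (R⊆N[v] v Rw)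

  commonNbhdSize : Vertex G → Vertex G → ℕ
  commonNbhdSize v x = countV G (λ w → adj G v w ∧ inClosedNbhd G x w)

  commonNbhdSize<commonClosedNbhdSize : ∀ {v x} → Adjacent G v x →
    commonNbhdSize v x < commonClosedNbhdSize G v x
  commonNbhdSize<commonClosedNbhdSize {v} {x} vx =
    ≤-trans (countV-insert v _ (λ w → to T-≡ ∘ proj₁ ∘ to T-∧))
            (length-filterᵇ-mono v∪N∩N[x]⊆N[v]∩N[x] (allFin (n G)))
    where
    v∪N∩N[x]⊆N[v]∩N[x] : ∀ w → T (⌊ v ≟ w ⌋ ∨ (adj G v w ∧ inClosedNbhd G x w)) →
      T ((⌊ v ≟ w ⌋ ∨ adj G v w) ∧ inClosedNbhd G x w)
    v∪N∩N[x]⊆N[v]∩N[x] w with v ≟ w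
    ... | yes refl = λ _ → adjacent⇒inClosedNbhd (adjacent-sym vx)
    ... | no _     = λ w∈ → w∈

  countV-∖closedNbhd : ∀ {v} x (S : Vertex G → Bool) → (∀ w → T (S w) → Adjacent G v w) →
    countV G S ≤ commonNbhdSize v x + countV G (λ w → S w ∧ not (inClosedNbhd G x w))
  countV-∖closedNbhd {v} x S S⊆N[v] = begin
    countV G S
      ≡⟨ length-filterᵇ-split S (inClosedNbhd G x) (allFin (n G)) ⟩
    countV G (λ w → S w ∧ inClosedNbhd G x w) + countV G (λ w → S w ∧ not (inClosedNbhd G x w))
      ≤⟨ +-monoˡ-≤ _ (length-filterᵇ-mono S∩N[x]⊆N∩N[x] (allFin (n G))) ⟩
    commonNbhdSize v x + countV G (λ w → S w ∧ not (inClosedNbhd G x w))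
      ∎
    where
    open ≤-Reasoning
    S∩N[x]⊆N∩N[x] : ∀ w → T (S w ∧ inClosedNbhd G x w) → T (adj G v w ∧ inClosedNbhd G x w)
    S∩N[x]⊆N∩N[x] w w∈ with Sw , w∈N[x] ← to T-∧ w∈ = from T-∧ (from T-≡ (S⊆N[v] w Sw) , w∈N[x])

  StarAt : Vertex G → ℕ → Set
  StarAt c k = Σ (Fin k → Vertex G) λ f →
    Injective _≡_ _≡_ f × (∀ i → Adjacent G c (f i)) × (∀ i j → i ≢ j → ¬ Adjacent G (f i) (f j))

  emptyStar : ∀ c → StarAt c 0
  emptyStar c = []ᶠ , (λ { {()} }) , (λ ()) , (λ ())

  extendStar : ∀ {c k x} (s : StarAt c k) → Adjacent G c x →
    (∀ i → ¬ T (inClosedNbhd G (proj₁ s i) x)) → StarAt c (suc k)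
  extendStar {c} {x = x} (f , f-inj , c~f , f-indep) c~x x∉ = x ∷ᶠ f , inj , c~ , indep
    where
    inj : Injective _≡_ _≡_ (x ∷ᶠ f)
    inj {zero}  {zero}  _     = refl
    inj {zero}  {suc j} x≡fj  = ⊥-elim (proj₁ (∉ClosedNbhd⇒ (x∉ j)) (sym x≡fj))
    inj {suc i} {zero}  fi≡x  = ⊥-elim (proj₁ (∉ClosedNbhd⇒ (x∉ i)) fi≡x)
    inj {suc i} {suc j} fi≡fj = cong suc (f-inj fi≡fj)
    c~ : ∀ i → Adjacent G c ((x ∷ᶠ f) i)
    c~ zero    = c~x
    c~ (suc i) = c~f i
    indep : ∀ i j → i ≢ j → ¬ Adjacent G ((x ∷ᶠ f) i) ((x ∷ᶠ f) j)
    indep zero    zero    _   = adjacent-irrefl x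
    indep zero    (suc j) _   = proj₂ (∉ClosedNbhd⇒ (x∉ j)) ∘ adjacent-sym
    indep (suc i) zero    _   = proj₂ (∉ClosedNbhd⇒ (x∉ i))
    indep (suc i) (suc j) i≢j = f-indep i j (i≢j ∘ cong suc)

  starFree⇒degree≤ : ∀ {ℓ} b v → StarFree (suc ℓ) G →
    (∀ x → Adjacent G v x → commonNbhdSize v x ≤ b) → degree G v ≤ ℓ * b
  starFree⇒degree≤ {ℓ} b v noStar small =
    grow (suc ℓ) 0 (+-identityʳ (suc ℓ)) (emptyStar v) (adj G v) (λ w v~w → to T-≡ v~w , λ ()) ≤-refl
    where
    -- Each of the k leaves picked so far has ruled out at most b neighbours of v;
    -- S holds those not yet ruled out.
    grow : ∀ r k → r + k ≡ suc ℓ → (s : StarAt v k) → (S : Vertex G → Bool) →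
      (∀ w → T (S w) → Adjacent G v w × ∀ i → ¬ T (inClosedNbhd G (proj₁ s i) w)) →
      degree G v ≤ k * b + countV G S → degree G v ≤ ℓ * b
    grow zero k r+k≡ s _ _ _ = ⊥-elim (noStar (v , subst (StarAt v) r+k≡ s))
    grow (suc r) k r+k≡ s S S-inv deg≤ with any? (λ w → T? (S w))
    ... | no S-empty = begin
      degree G v          ≤⟨ deg≤ ⟩
      k * b + countV G S  ≡⟨ cong (k * b +_) (length-filterᵇ-none (λ w Sw → S-empty (w , Sw)) (allFin (n G))) ⟩
      k * b + 0           ≡⟨ +-identityʳ (k * b) ⟩
      k * b               ≤⟨ *-monoˡ-≤ b (subst (k ≤_) (suc-injective r+k≡) (m≤n+m k r)) ⟩
      ℓ * b               ∎
      where open ≤-Reasoning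
    ... | yes (x , Sx) =
      grow r (suc k) (trans (+-suc r k) r+k≡) (extendStar s v~x (proj₂ (S-inv x Sx))) S′ S′-inv deg≤′
      where
      open ≤-Reasoning
      v~x = proj₁ (S-inv x Sx)
      S′ : Vertex G → Bool
      S′ w = S w ∧ not (inClosedNbhd G x w)
      S′-inv : ∀ w → T (S′ w) → Adjacent G v w × ∀ i → ¬ T (inClosedNbhd G ((x ∷ᶠ proj₁ s) i) w)
      S′-inv w S′w with Sw , w∉N[x] ← to T-∧ S′w = proj₁ (S-inv w Sw) , λ
        { zero    → T-not⇒¬T w∉N[x]
        ; (suc i) → proj₂ (S-inv w Sw) i }
      deg≤′ : degree G v ≤ suc k * b + countV G S′
      deg≤′ = begin
        degree G v                          ≤⟨ deg≤ ⟩
        k * b + countV G S                  ≤⟨ +-monoʳ-≤ (k * b) (countV-∖closedNbhd x S (proj₁ ∘₂ S-inv)) ⟩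
        k * b + (commonNbhdSize v x + countV G S′)
                                            ≤⟨ +-monoʳ-≤ (k * b) (+-monoˡ-≤ (countV G S′) (small x v~x)) ⟩
        k * b + (b + countV G S′)           ≡⟨ sym (+-assoc (k * b) b _) ⟩
        k * b + b + countV G S′             ≡⟨ cong (_+ countV G S′) (+-comm (k * b) b) ⟩
        suc k * b + countV G S′             ∎

  largeCommonNbhd : ∀ {ℓ} t v → StarFree (suc ℓ) G → ℓ * (t ∸ 1) < degree G v →
    Σ (Vertex G) λ u → Adjacent G v u × t + 1 ≤ commonClosedNbhdSize G v u
  largeCommonNbhd t v noStar deg>
    with any? (λ u → (adj G v u ≟ᵇ true) ×-dec (t + 1 ≤? commonClosedNbhdSize G v u))
  ... | yes found = found
  ... | no none   = ⊥-elim (<⇒≱ deg> (starFree⇒degree≤ (t ∸ 1) v noStar small))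
    where
    small : ∀ x → Adjacent G v x → commonNbhdSize v x ≤ t ∸ 1
    small x v~x = ∸-monoˡ-≤ 1 (≤-trans (commonNbhdSize<commonClosedNbhdSize v~x) common≤t)
      where
      common≤t : commonClosedNbhdSize G v x ≤ t
      common≤t = m<1+n⇒m≤n (subst (commonClosedNbhdSize G v x <_) (+-comm t 1) (≰⇒> (λ large → none (x , v~x , large))))

  hasClique-≤ : ∀ {m k} → m ≤ k → HasClique G k → HasClique G m
  hasClique-≤ m≤k (f , f-inj , f-clique) =
    f ∘ ι , ι-inj ∘ f-inj , λ i j i≢j → f-clique (ι i) (ι j) (i≢j ∘ ι-inj)
    where
    ι = λ i → inject≤ i m≤k
    ι-inj : Injective _≡_ _≡_ ι
    ι-inj {i} {j} = inject≤-injective m≤k m≤k i j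

  countV-clique : (K : Vertex G → Bool) → (∀ a b → a ≢ b → T (K a) → T (K b) → Adjacent G a b) →
    HasClique G (countV G K)
  countV-clique K K-clique =
    lookup L , lookup-injective L-unique ,
    λ i j i≢j → K-clique _ _ (i≢j ∘ lookup-injective L-unique) (K∋ i) (K∋ j)
    where
    L = filterᵇ K (allFin (n G))
    L-unique : Unique L
    L-unique = filter⁺ (T? ∘ K) (allFin⁺ (n G))
    K∋ : ∀ i → T (K (lookup L i))
    K∋ i = proj₂ (∈-filter⁻ (T? ∘ K) {xs = allFin (n G)} (∈-lookup {xs = L} i))

  clawFree⇒clique : ∀ {v u} → ClawFree G → Adjacent G v u →
    HasClique G (degree G v + 2 ∸ commonClosedNbhdSize G v u)
  clawFree⇒clique {v} {u} noClaw v~u = hasClique-≤ size (countV-clique K K-clique)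
    where
    Q K : Vertex G → Bool
    Q w = adj G v w ∧ not (inClosedNbhd G u w)
    K w = ⌊ v ≟ w ⌋ ∨ Q w

    Q⇒ : ∀ {w} → T (Q w) → Adjacent G v w × ¬ T (inClosedNbhd G u w)
    Q⇒ Qw with v~w , w∉N[u] ← to T-∧ Qw = to T-≡ v~w , T-not⇒¬T w∉N[u]

    Q-clique : ∀ a b → a ≢ b → T (Q a) → T (Q b) → Adjacent G a b
    Q-clique a b a≢b Qa Qb with adj G a b in a≁b
    ... | true  = refl
    ... | false = ⊥-elim (noClaw (v , extendStar (extendStar (extendStar (emptyStar v) v~u (λ ()))
                    v~a λ { zero → u∉a }) v~b λ { zero → a∉b ; (suc zero) → u∉b }))
      where
      v~a = proj₁ (Q⇒ Qa)
      v~b = proj₁ (Q⇒ Qb)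
      u∉a = proj₂ (Q⇒ Qa)
      u∉b = proj₂ (Q⇒ Qb)
      a∉b : ¬ T (inClosedNbhd G a b)
      a∉b = [ a≢b , ¬adjacent a≁b ] ∘ inClosedNbhd⇒

    K-clique : ∀ a b → a ≢ b → T (K a) → T (K b) → Adjacent G a b
    K-clique a b a≢b Ka Kb with to (T-∨ {⌊ v ≟ a ⌋}) Ka | to (T-∨ {⌊ v ≟ b ⌋}) Kb
    ... | inj₁ v≡a | inj₁ v≡b = ⊥-elim (a≢b (trans (sym (≟-true⇒≡ v≡a)) (≟-true⇒≡ v≡b)))
    ... | inj₁ v≡a | inj₂ Qb  = subst (λ a → Adjacent G a b) (≟-true⇒≡ v≡a) (proj₁ (Q⇒ Qb))
    ... | inj₂ Qa  | inj₁ v≡b = subst (Adjacent G a) (≟-true⇒≡ v≡b) (adjacent-sym (proj₁ (Q⇒ Qa)))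
    ... | inj₂ Qa  | inj₂ Qb  = Q-clique a b a≢b Qa Qb

    size : degree G v + 2 ∸ commonClosedNbhdSize G v u ≤ countV G K
    size = m≤n+o⇒m∸n≤o (degree G v + 2) (commonClosedNbhdSize G v u) (begin
      degree G v + 2                           ≡⟨ cong (_+ 2) (length-filterᵇ-split (adj G v) (inClosedNbhd G u) (allFin (n G))) ⟩
      commonNbhdSize v u + countV G Q + 2      ≡⟨ trans (+-comm _ 2) (cong suc (sym (+-suc (commonNbhdSize v u) (countV G Q)))) ⟩
      suc (commonNbhdSize v u) + suc (countV G Q)
        ≤⟨ +-mono-≤ (commonNbhdSize<commonClosedNbhdSize v~u) (countV-insert v Q (λ w → proj₁ ∘ Q⇒)) ⟩
      commonClosedNbhdSize G v u + countV G K  ∎)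
      where open ≤-Reasoning

lemma3p3 : (ℓ : ℕ) .{{_ : NonZero ℓ}} (G : Graph) →
    StarFree (suc ℓ) G → 1 ≤ maxDegree G →
    (Σ (Vertex G) λ v₁ → Σ (Vertex G) λ v₂ → Adjacent G v₁ v₂ ×
       ⌈ maxDegree G / ℓ ⌉ + 1 ≤ commonClosedNbhdSize G v₁ v₂)
    ×
    (ClawFree G →
      Σ (Vertex G) λ v₁ → Σ (Vertex G) λ v₂ → Adjacent G v₁ v₂ ×
       ⌈ maxDegree G / ℓ ⌉ + 1 ≤ commonClosedNbhdSize G v₁ v₂ ×
       HasClique G ((maxDegree G + 2) ∸ commonClosedNbhdSize G v₁ v₂))
lemma3p3 ℓ G noStar Δ≥1
  with v , deg≡Δ ← maxDegree-attained G Δ≥1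
  with u , v~u , large ← largeCommonNbhd G ⌈ maxDegree G / ℓ ⌉ v noStar
         (subst (ℓ * (⌈ maxDegree G / ℓ ⌉ ∸ 1) <_) (sym deg≡Δ) (n*[⌈m/n⌉∸1]<m (maxDegree G) ℓ Δ≥1))
  = (v , u , v~u , large) ,
    λ noClaw → v , u , v~u , large ,
      subst (λ d → HasClique G (d + 2 ∸ commonClosedNbhdSize G v u)) deg≡Δ (clawFree⇒clique G noClaw v~u)
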